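{- Let $T$ be a full $k$-ary tree ($k\geq 2$) of order $n$ and height $h$. Let $t = (h+1) \bmod 3$ and $t' = (h-1) \bmod 2$. Then $\dfrac{\mathrm{cdn}(T)}{n} = \dfrac{2^{h+1}-2^t}{7(2^{h+1}-1)}$ if $k=2$, and $\dfrac{\mathrm{cdn}(T)}{n} = \dfrac{k^{h+1}-k^{t'}}{(k+1)(k^{h+1}-1)}$ if $k\geq 3$. In addition, if $t = t' = 0$, then $\dfrac{\mathrm{cdn}(T)}{n} = \dfrac17$ if $k=2$, and $\dfrac{\mathrm{cdn}(T)}{n} = \dfrac{1}{k+1}$ if $k\geq 3$.
   Context: A claw is $K_{1,3}$. $\mathrm{cdn}(G)$ is the minimum number of vertices whose deletion from $G$ leaves a graph with no induced $K_{1,3}$. A full $k$-ary tree is a rooted tree in which every node has either zero or exactly $k$ children and all leaves have the same depth; its height is the depth of its leaves (the depth of a vertex being its distance to the root). -}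

module Defs where

open import Data.Nat using (ℕ; zero; suc; _+_; _*_; _∸_; _^_; _≤_; _%_)
open import Data.Integer using (+_)
open import Data.Rational using (ℚ; _/_; 0ℚ)
open import Data.List using (List; []; _∷_; length)
open import Data.List.Membership.Propositional using (_∈_; _∉_)
open import Data.List.Relation.Unary.All using (All)
open import Data.List.Relation.Unary.Unique.Propositional using (Unique)
open import Data.Product using (Σ; _×_)
open import Data.Sum using (_⊎_)
open import Relation.Binary.PropositionalEquality using (_≡_; _≢_)
open import Relation.Nullary using (¬_)

record Graph : Set₁ where
  field
    V   : Set
    Adj : V → V → Set

open Graph public

record InducedClawAvoiding (G : Graph) (S : List (V G)) : Set where
  field
    c x y z : V G
    c∉S : c ∉ S
    x∉S : x ∉ S
    y∉S : y ∉ S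
    z∉S : z ∉ S
    cx : Adj G c x
    cy : Adj G c y
    cz : Adj G c z
    x≢y : x ≢ y
    x≢z : x ≢ z
    y≢z : y ≢ z
    ¬xy : ¬ Adj G x y
    ¬xz : ¬ Adj G x z
    ¬yz : ¬ Adj G y z

ClawFreeAfterDeleting : (G : Graph) → List (V G) → Set
ClawFreeAfterDeleting G S = ¬ InducedClawAvoiding G S

IsCdn : Graph → ℕ → Set
IsCdn G m =
  Σ (List (V G)) (λ S → Unique S × length S ≡ m × ClawFreeAfterDeleting G S)
  × (∀ (S : List (V G)) → Unique S → ClawFreeAfterDeleting G S → m ≤ length S)

data Tree : Set where
  node : List Tree → Tree

data Full (k : ℕ) : ℕ → Tree → Set where
  leaf     : Full k 0 (node [])
  internal : ∀ {h ts} → length ts ≡ k → All (Full k h) ts → Full k (suc h) (node ts)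

-- Vertices (positions) of a tree.  t ∈ ts is positional (Any), so
-- equal subtrees at different positions give different vertices.
data Pos : Tree → Set where
  root  : ∀ {ts} → Pos (node ts)
  child : ∀ {ts t} → t ∈ ts → Pos t → Pos (node ts)

data Edge : ∀ {t} → Pos t → Pos t → Set where
  root-child : ∀ {ts us} (m : node us ∈ ts) → Edge (root {ts}) (child m (root {us}))
  deeper     : ∀ {ts t} (m : t ∈ ts) {p q : Pos t} → Edge p q → Edge (child m p) (child m q)

treeGraph : Tree → Graph
treeGraph t = record { V = Pos t ; Adj = λ p q → Edge p q ⊎ Edge q p }

-- Rational a/b for naturals (b = 0 ↦ 0; never used with b = 0 below).

_/ℚ_ : ℕ → ℕ → ℚ
a /ℚ zero  = 0ℚ
a /ℚ suc b = + a / suc b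

infixl 7 _/ℚ_

-- A set S whose deletion leaves G claw-free meets every induced claw, so a family of pairwise
-- disjoint claws indexed by P forces |S| ≥ |P|; if deleting P itself leaves G claw-free, then
-- cdn(G) = |P|.  Measure the height of a vertex from the leaves.  For k ≥ 3, let P be the vertices
-- of odd height: each is the centre of a claw with three of its children, and deleting them leaves
-- no edges.  For k = 2 a vertex has at most two children, so an induced claw consists of a centre
-- together with its parent and a child, spanning three consecutive heights; let P be the vertices
-- of height ≡ 2 (mod 3), and charge to each p ∈ P the claw centred at a child of p whose leaves
-- are p and two grandchildren of p.  There are k^(h-j) vertices at height j, which gives the
-- closed forms.

module Submission where

open import Defs
open import Data.Bool using (Bool; true; false; not)
open import Data.Bool.Properties using (¬-not; not-injective; not-involutive)
open import Data.Nat using (ℕ; zero; suc; _+_; _*_; _∸_; _^_; _≤_; _<_; _%_; s≤s; z≤n; NonZero)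
open import Data.Nat.Properties
open import Data.Nat.DivMod using ([m+n]%n≡m%n)
open import Data.Nat.Tactic.RingSolver using (solve-∀)
open import Data.Fin using (Fin)
import Data.Fin.Properties as Fin
open import Data.List using (List; []; _∷_; _++_; length; map; allFin)
open import Data.List.Properties using (length-map; length-++; length-tabulate; length-removeAt′)
open import Data.List.Relation.Unary.Any using (Any; here; there; index; any?)
open import Data.List.Relation.Unary.All as All using (All; []; _∷_)
open import Data.List.Relation.Unary.All.Properties using (¬Any⇒All¬)
open import Data.List.Membership.Propositional using (_∈_; _∉_; _─_)
open import Data.List.Membership.Propositional.Properties using (∈-map⁺; ∈-map⁻; ∈-allFin; ∈-++⁺ˡ; ∈-++⁺ʳ; ∈-++⁻)
import Data.List.Membership.DecPropositional as DecMembership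
open import Data.List.Relation.Binary.Subset.Propositional using (_⊆_)
open import Data.List.Relation.Binary.Disjoint.Propositional using (Disjoint)
open import Data.List.Relation.Unary.Unique.Propositional using (Unique; []; _∷_)
import Data.List.Relation.Unary.Unique.Propositional.Properties as Unique
open import Data.Product using (Σ; ∃; _×_; _,_)
import Data.Integer as ℤ
import Data.Integer.Properties as ℤ
open import Data.Rational.Properties using (fromℚᵘ-cong)
open import Data.Rational.Unnormalised using (mkℚᵘ; *≡*)
open import Data.Sum using (_⊎_; inj₁; inj₂)
open import Data.Empty using (⊥; ⊥-elim)
open import Function.Base using (_∋_; _∘_; id)
open import Function.Bundles using (_↔_; Inverse; Injection)
open import Function.Properties.Inverse using (↔⇒↣)
open import Relation.Nullary using (¬_; yes; no)
open import Relation.Binary.Definitions using (DecidableEquality)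
open import Relation.Binary.PropositionalEquality

∈-─⁺ : ∀ {A : Set} {xs : List A} {x y : A} (x∈xs : x ∈ xs) → y ∈ xs → y ≢ x → y ∈ xs ─ x∈xs
∈-─⁺ (here refl) (here refl) y≢x = ⊥-elim (y≢x refl)
∈-─⁺ (here _)    (there y∈xs) _  = y∈xs
∈-─⁺ (there _)   (here refl) _   = here refl
∈-─⁺ (there x∈xs) (there y∈xs) y≢x = there (∈-─⁺ x∈xs y∈xs y≢x)

Unique⇒length-≤ : ∀ {A : Set} {xs ys : List A} → Unique xs → xs ⊆ ys → length xs ≤ length ys
Unique⇒length-≤ {xs = []} _ _ = z≤n
Unique⇒length-≤ {xs = x ∷ xs} {ys} (x∉xs ∷ uxs) xs⊆ys = begin
  suc (length xs)          ≤⟨ s≤s (Unique⇒length-≤ uxs xs⊆ys─x) ⟩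
  suc (length (ys ─ x∈ys)) ≡⟨ length-removeAt′ ys (index x∈ys) ⟨
  length ys                ∎
  where
  open ≤-Reasoning
  x∈ys = xs⊆ys (here refl)
  xs⊆ys─x : xs ⊆ ys ─ x∈ys
  xs⊆ys─x y∈xs = ∈-─⁺ x∈ys (xs⊆ys (there y∈xs)) (λ { refl → All.lookup x∉xs y∈xs refl })

enumeration-length : ∀ {A : Set} {n} → A ↔ Fin n → (xs : List A) → Unique xs → (∀ x → x ∈ xs) → length xs ≡ n
enumeration-length {n = n} A↔Fin xs uxs complete = ≤-antisym
  (begin
    length xs            ≡⟨ length-map to xs ⟨
    length (map to xs)   ≤⟨ Unique⇒length-≤ (Unique.map⁺ to-injective uxs) (λ _ → ∈-allFin _) ⟩
    length (allFin n)    ≡⟨ length-tabulate _ ⟩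
    n                    ∎)
  (begin
    n                    ≡⟨ length-tabulate _ ⟨
    length (allFin n)    ≤⟨ Unique⇒length-≤ (Unique.allFin⁺ n) allFin⊆ ⟩
    length (map to xs)   ≡⟨ length-map to xs ⟩
    length xs            ∎)
  where
  open Inverse A↔Fin
  open ≤-Reasoning
  to-injective : ∀ {x y} → to x ≡ to y → x ≡ y
  to-injective = Injection.injective (↔⇒↣ A↔Fin)
  allFin⊆ : allFin n ⊆ map to xs
  allFin⊆ {i} _ = subst (_∈ map to xs) (strictlyInverseˡ i) (∈-map⁺ to (complete (from i)))

record InducedClaw (G : Graph) : Set where
  field
    c x y z : V G
    cx : Adj G c x
    cy : Adj G c y
    cz : Adj G c z
    x≢y : x ≢ y
    x≢z : x ≢ z
    y≢z : y ≢ z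
    ¬xy : ¬ Adj G x y
    ¬xz : ¬ Adj G x z
    ¬yz : ¬ Adj G y z

  vertices : List (V G)
  vertices = c ∷ x ∷ y ∷ z ∷ []

  avoiding : ∀ {S} → All (_∉ S) vertices → InducedClawAvoiding G S
  avoiding (c∉S ∷ x∉S ∷ y∉S ∷ z∉S ∷ []) = record
    { c = c ; x = x ; y = y ; z = z
    ; c∉S = c∉S ; x∉S = x∉S ; y∉S = y∉S ; z∉S = z∉S
    ; cx = cx ; cy = cy ; cz = cz
    ; x≢y = x≢y ; x≢z = x≢z ; y≢z = y≢z
    ; ¬xy = ¬xy ; ¬xz = ¬xz ; ¬yz = ¬yz }

claw-meets : ∀ {G S} → DecidableEquality (V G) → ClawFreeAfterDeleting G S →
  (C : InducedClaw G) → Any (_∈ S) (InducedClaw.vertices C)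
claw-meets {S = S} _≟_ claw-free C with any? (λ v → DecMembership._∈?_ _≟_ v S) (InducedClaw.vertices C)
... | yes hit  = hit
... | no  miss = ⊥-elim (claw-free (InducedClaw.avoiding C (¬Any⇒All¬ _ miss)))

-- Pairwise disjoint claws, one for each p ∈ P: the claw of p lies in the fibre of owner over p.
record ClawPacking (G : Graph) (P : List (V G)) : Set where
  field
    owner : V G → V G
    claw  : ∀ {p} → p ∈ P → Σ (InducedClaw G) λ C → All (λ v → owner v ≡ p) (InducedClaw.vertices C)

module _ {G : Graph} (_≟_ : DecidableEquality (V G)) {P : List (V G)} (packing : ClawPacking G P) where
  open ClawPacking packing

  packing-length-≤ : Unique P → ∀ {S} → ClawFreeAfterDeleting G S → length P ≤ length S
  packing-length-≤ uP {S} claw-free = begin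
    length P             ≤⟨ Unique⇒length-≤ uP P⊆owners ⟩
    length (map owner S) ≡⟨ length-map owner S ⟩
    length S             ∎
    where
    open ≤-Reasoning
    owned-hit : ∀ {p vs} → Any (_∈ S) vs → All (λ v → owner v ≡ p) vs → p ∈ map owner S
    owned-hit (here v∈S)  (refl ∷ _)  = ∈-map⁺ owner v∈S
    owned-hit (there hit) (_ ∷ owned) = owned-hit hit owned
    P⊆owners : P ⊆ map owner S
    P⊆owners p∈P with claw p∈P
    ... | C , owned = owned-hit (claw-meets _≟_ claw-free C) owned

  packing⇒IsCdn : Unique P → ClawFreeAfterDeleting G P → IsCdn G (length P)
  packing⇒IsCdn uP claw-free = (P , uP , refl , claw-free) , λ S _ → packing-length-≤ uP

depth : ∀ {t} → Pos t → ℕ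
depth root        = 0
depth (child _ p) = suc (depth p)

Edge-depth : ∀ {t} {p q : Pos t} → Edge p q → depth q ≡ suc (depth p)
Edge-depth (root-child _) = refl
Edge-depth (deeper _ e)   = cong suc (Edge-depth e)

Adj-depth : ∀ {t} {p q : Pos t} → Adj (treeGraph t) p q → depth q ≡ suc (depth p) ⊎ depth p ≡ suc (depth q)
Adj-depth (inj₁ e) = inj₁ (Edge-depth e)
Adj-depth (inj₂ e) = inj₂ (Edge-depth e)

¬Adj-equal-depth : ∀ {t} {p q : Pos t} → depth p ≡ depth q → ¬ Adj (treeGraph t) p q
¬Adj-equal-depth eq adj with Adj-depth adj
... | inj₁ e = 1+n≢n (trans (sym e) (sym eq))
... | inj₂ e = 1+n≢n (trans (sym e) eq)

¬Adj-depth-gap-2 : ∀ {t} {p q : Pos t} → depth q ≡ 2 + depth p → ¬ Adj (treeGraph t) p q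
¬Adj-depth-gap-2 eq adj with Adj-depth adj
... | inj₁ e = m≢1+n+m _ (suc-injective (trans (sym e) eq))
... | inj₂ e = m≢1+n+m _ (trans e (cong suc eq))

Edge-parent-unique : ∀ {t} {p p′ q : Pos t} → Edge p q → Edge p′ q → p ≡ p′
Edge-parent-unique (root-child _) (root-child _) = refl
Edge-parent-unique (deeper m e)   (deeper .m e′) = cong (child m) (Edge-parent-unique e e′)

ancestorAt : ∀ {t} → ℕ → Pos t → Pos t
ancestorAt {node _} zero    _           = root
ancestorAt          (suc _) root        = root
ancestorAt          (suc d) (child m p) = child m (ancestorAt d p)

ancestorAt-depth : ∀ {t} (p : Pos t) → ancestorAt (depth p) p ≡ p
ancestorAt-depth root        = refl
ancestorAt-depth (child m p) = cong (child m) (ancestorAt-depth p)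

ancestorAt-Edge : ∀ {t} {p q : Pos t} → Edge p q → ∀ d → d ≤ depth p → ancestorAt d q ≡ ancestorAt d p
ancestorAt-Edge (root-child _) zero    z≤n       = refl
ancestorAt-Edge (deeper _ _)   zero    _         = refl
ancestorAt-Edge (deeper m e)   (suc d) (s≤s d≤p) = cong (child m) (ancestorAt-Edge e d d≤p)

ancestorAbove : ∀ {t} → ℕ → Pos t → Pos t
ancestorAbove i p = ancestorAt (depth p ∸ i) p

ancestorAbove-Edge : ∀ {t} {p q : Pos t} → Edge p q → ∀ i → ancestorAbove (suc i) q ≡ ancestorAbove i p
ancestorAbove-Edge {p = p} {q} e i = begin
  ancestorAt (depth q ∸ suc i) q ≡⟨ cong (λ d → ancestorAt (d ∸ suc i) q) (Edge-depth e) ⟩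
  ancestorAt (depth p ∸ i) q     ≡⟨ ancestorAt-Edge e (depth p ∸ i) (m∸n≤m (depth p) i) ⟩
  ancestorAt (depth p ∸ i) p     ∎
  where open ≡-Reasoning

Branch : List Tree → Set
Branch ts = ∃ (_∈ ts)

∈-index-injective : ∀ {ts u u′} (a : u ∈ ts) (b : u′ ∈ ts) →
  index a ≡ index b → (Branch ts ∋ (u , a)) ≡ (u′ , b)
∈-index-injective (here refl) (here refl) _  = refl
∈-index-injective (there a)   (there b)   eq with ∈-index-injective a b (Fin.suc-injective eq)
... | refl = refl

child-index : ∀ {ts u u′} {a : u ∈ ts} {b : u′ ∈ ts} {q : Pos u} {q′ : Pos u′} →
  child a q ≡ child b q′ → index a ≡ index b
child-index refl = refl

child-injective : ∀ {ts u} {a : u ∈ ts} {q q′ : Pos u} → child a q ≡ child a q′ → q ≡ q′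
child-injective refl = refl

_≟ₚ_ : ∀ {t} → DecidableEquality (Pos t)
root      ≟ₚ root      = yes refl
root      ≟ₚ child _ _ = no λ ()
child _ _ ≟ₚ root      = no λ ()
child a p ≟ₚ child b q with index a Fin.≟ index b
... | no  a≢b = no λ eq → a≢b (child-index eq)
... | yes a≡b with ∈-index-injective a b a≡b
...   | refl with p ≟ₚ q
...     | yes refl = yes refl
...     | no  p≢q  = no λ eq → p≢q (child-injective eq)

Unique-branches-length-≤ : ∀ {ts} (bs : List (Branch ts)) → Unique bs → length bs ≤ length ts
Unique-branches-length-≤ {ts} bs ubs = begin
  length bs                        ≡⟨ length-map branchIndex bs ⟨
  length (map branchIndex bs)      ≤⟨ Unique⇒length-≤ (Unique.map⁺ injective ubs) (λ _ → ∈-allFin _) ⟩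
  length (allFin (length ts))      ≡⟨ length-tabulate _ ⟩
  length ts                        ∎
  where
  open ≤-Reasoning
  branchIndex : Branch ts → Fin (length ts)
  branchIndex (_ , a) = index a
  injective : ∀ {b b′} → branchIndex b ≡ branchIndex b′ → b ≡ b′
  injective {_ , a} {_ , a′} = ∈-index-injective a a′

height : ∀ {t} → ℕ → Pos t → ℕ
height h p = h ∸ depth p

depth-≤ : ∀ {k h t} → Full k h t → (p : Pos t) → depth p ≤ h
depth-≤ _                 root        = z≤n
depth-≤ (internal _ full) (child m p) = s≤s (depth-≤ (All.lookup full m) p)

Edge-height : ∀ {k h t} → Full k h t → {p q : Pos t} → Edge p q → height h p ≡ suc (height h q)
Edge-height {h = h} full {p} {q} e =
  trans (∸-suc h (depth p) (subst (_≤ h) (Edge-depth e) (depth-≤ full q))) (cong (λ d → suc (h ∸ d)) (sym (Edge-depth e)))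
  where
  ∸-suc : ∀ m n → suc n ≤ m → m ∸ n ≡ suc (m ∸ suc n)
  ∸-suc (suc m) zero    _         = refl
  ∸-suc (suc m) (suc n) (s≤s n<m) = ∸-suc m n n<m

three-children⇒3≤k : ∀ {k h t} → Full k h t → {p x y z : Pos t} → Edge p x → Edge p y → Edge p z →
  x ≢ y → x ≢ z → y ≢ z → 3 ≤ k
three-children⇒3≤k (internal {ts = ts} len _) (root-child a) (root-child b) (root-child d) x≢y x≢z y≢z =
  subst (3 ≤_) len (Unique-branches-length-≤ {ts} ((_ , a) ∷ (_ , b) ∷ (_ , d) ∷ [])
    (((λ { refl → x≢y refl }) ∷ (λ { refl → x≢z refl }) ∷ []) ∷ ((λ { refl → y≢z refl }) ∷ []) ∷ [] ∷ []))
three-children⇒3≤k (internal _ full) (deeper m ex) (deeper .m ey) (deeper .m ez) x≢y x≢z y≢z =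
  three-children⇒3≤k (All.lookup full m) ex ey ez (x≢y ∘ cong (child m)) (x≢z ∘ cong (child m)) (y≢z ∘ cong (child m))

two-children : ∀ {k h t} → Full k h t → 2 ≤ k → (p : Pos t) → depth p < h →
  Σ (Pos t) λ c₁ → Σ (Pos t) λ c₂ → Edge p c₁ × Edge p c₂ × c₁ ≢ c₂
two-children (internal {ts = node _ ∷ node _ ∷ _} _ _) _ root _ =
  _ , _ , root-child (here refl) , root-child (there (here refl)) , λ ()
two-children (internal {ts = []} refl _) () root _
two-children (internal {ts = _ ∷ []} refl _) (s≤s ()) root _
two-children (internal _ full) 2≤k (child m p) (s≤s p<h) with two-children (All.lookup full m) 2≤k p p<h
... | c₁ , c₂ , e₁ , e₂ , c₁≢c₂ = _ , _ , deeper m e₁ , deeper m e₂ , c₁≢c₂ ∘ child-injective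

three-children : ∀ {k h t} → Full k h t → 3 ≤ k → (p : Pos t) → depth p < h →
  Σ (Pos t) λ c₁ → Σ (Pos t) λ c₂ → Σ (Pos t) λ c₃ →
    Edge p c₁ × Edge p c₂ × Edge p c₃ × c₁ ≢ c₂ × c₁ ≢ c₃ × c₂ ≢ c₃
three-children (internal {ts = node _ ∷ node _ ∷ node _ ∷ _} _ _) _ root _ =
  _ , _ , _ , root-child (here refl) , root-child (there (here refl)) , root-child (there (there (here refl))) ,
  (λ ()) , (λ ()) , (λ ())
three-children (internal {ts = []} refl _) () root _
three-children (internal {ts = _ ∷ []} refl _) (s≤s ()) root _
three-children (internal {ts = _ ∷ _ ∷ []} refl _) (s≤s (s≤s ())) root _
three-children (internal _ full) 3≤k (child m p) (s≤s p<h) with three-children (All.lookup full m) 3≤k p p<h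
... | c₁ , c₂ , c₃ , e₁ , e₂ , e₃ , c₁≢c₂ , c₁≢c₃ , c₂≢c₃ =
  _ , _ , _ , deeper m e₁ , deeper m e₂ , deeper m e₃ ,
  c₁≢c₂ ∘ child-injective , c₁≢c₃ ∘ child-injective , c₂≢c₃ ∘ child-injective

fromBool : Bool → ℕ
fromBool false = 0
fromBool true  = 1

consIf : ∀ {A : Set} → Bool → A → List A → List A
consIf false _ xs = xs
consIf true  x xs = x ∷ xs

length-consIf : ∀ {A : Set} b (x : A) xs → length (consIf b x xs) ≡ fromBool b + length xs
length-consIf false _ _ = refl
length-consIf true  _ _ = refl

∈-consIf⁺ : ∀ {A : Set} b {x y : A} {xs} → y ∈ xs → y ∈ consIf b x xs
∈-consIf⁺ false y∈xs = y∈xs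
∈-consIf⁺ true  y∈xs = there y∈xs

∈-consIf-here : ∀ {A : Set} {b} {x : A} xs → b ≡ true → x ∈ consIf b x xs
∈-consIf-here _ refl = here refl

∈-consIf⁻ : ∀ {A : Set} b {x y : A} {xs} → y ∈ consIf b x xs → (b ≡ true × y ≡ x) ⊎ y ∈ xs
∈-consIf⁻ false y∈xs         = inj₂ y∈xs
∈-consIf⁻ true  (here y≡x)   = inj₁ (refl , y≡x)
∈-consIf⁻ true  (there y∈xs) = inj₂ y∈xs

Unique-consIf : ∀ {A : Set} b {x : A} {xs} → x ∉ xs → Unique xs → Unique (consIf b x xs)
Unique-consIf false _    uxs = uxs
Unique-consIf true  x∉xs uxs = All.tabulate (λ y∈xs x≡y → x∉xs (subst (_∈ _) (sym x≡y) y∈xs)) ∷ uxs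

-- branchPositionsWhere runs through a suffix us of the children ts of a node; us⊆ locates its
-- members in ts.
mutual
  positionsWhere : (ℕ → Bool) → (t : Tree) → List (Pos t)
  positionsWhere P (node ts) = consIf (P 0) root (branchPositionsWhere (P ∘ suc) ts id)

  branchPositionsWhere : (ℕ → Bool) → ∀ {ts} us → us ⊆ ts → List (Pos (node ts))
  branchPositionsWhere P []       _   = []
  branchPositionsWhere P (u ∷ us) us⊆ =
    map (child (us⊆ (here refl))) (positionsWhere P u) ++ branchPositionsWhere P us (us⊆ ∘ there)

∈-branchPositionsWhere⁺ : ∀ P {ts} us (us⊆ : us ⊆ ts) {u} (m : u ∈ us) {q : Pos u} →
  q ∈ positionsWhere P u → child (us⊆ m) q ∈ branchPositionsWhere P us us⊆
∈-branchPositionsWhere⁺ P (u ∷ us) us⊆ (here refl) q∈ = ∈-++⁺ˡ (∈-map⁺ (child (us⊆ (here refl))) q∈)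
∈-branchPositionsWhere⁺ P (u ∷ us) us⊆ (there m)   q∈ =
  ∈-++⁺ʳ (map (child (us⊆ (here refl))) (positionsWhere P u)) (∈-branchPositionsWhere⁺ P us (us⊆ ∘ there) m q∈)

∈-positionsWhere⁺ : ∀ P {t} (p : Pos t) → P (depth p) ≡ true → p ∈ positionsWhere P t
∈-positionsWhere⁺ P {node ts} root        Pp = ∈-consIf-here _ Pp
∈-positionsWhere⁺ P {node ts} (child m q) Pp =
  ∈-consIf⁺ (P 0) (∈-branchPositionsWhere⁺ (P ∘ suc) ts id m (∈-positionsWhere⁺ (P ∘ suc) q Pp))

mutual
  ∈-positionsWhere⁻ : ∀ P {t} (p : Pos t) → p ∈ positionsWhere P t → P (depth p) ≡ true
  ∈-positionsWhere⁻ P {node ts} p p∈ with ∈-consIf⁻ (P 0) p∈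
  ... | inj₁ (P0 , refl) = P0
  ... | inj₂ p∈′ with ∈-branchPositionsWhere⁻ (P ∘ suc) ts id p∈′
  ...   | _ , _ , _ , refl , Pq = Pq

  ∈-branchPositionsWhere⁻ : ∀ P {ts} us (us⊆ : us ⊆ ts) {p} → p ∈ branchPositionsWhere P us us⊆ →
    Σ Tree λ u → Σ (u ∈ us) λ m → Σ (Pos u) λ q → p ≡ child (us⊆ m) q × P (depth q) ≡ true
  ∈-branchPositionsWhere⁻ P (u ∷ us) us⊆ p∈ with ∈-++⁻ (map (child (us⊆ (here refl))) (positionsWhere P u)) p∈
  ... | inj₁ p∈u with ∈-map⁻ (child (us⊆ (here refl))) p∈u
  ...   | q , q∈ , refl = u , here refl , q , refl , ∈-positionsWhere⁻ P q q∈
  ∈-branchPositionsWhere⁻ P (u ∷ us) us⊆ p∈ | inj₂ p∈us with ∈-branchPositionsWhere⁻ P us (us⊆ ∘ there) p∈us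
  ...   | u′ , m , q , refl , Pq = u′ , there m , q , refl , Pq

mutual
  positionsWhere-unique : ∀ P t → Unique (positionsWhere P t)
  positionsWhere-unique P (node ts) =
    Unique-consIf (P 0) root∉ (branchPositionsWhere-unique (P ∘ suc) ts id (λ _ _ → id))
    where
    root∉ : root ∉ branchPositionsWhere (P ∘ suc) ts id
    root∉ root∈ with ∈-branchPositionsWhere⁻ (P ∘ suc) ts id root∈
    ... | _ , _ , _ , () , _

  branchPositionsWhere-unique : ∀ P {ts} us (us⊆ : us ⊆ ts) →
    (∀ {u u′} (a : u ∈ us) (b : u′ ∈ us) → index (us⊆ a) ≡ index (us⊆ b) → index a ≡ index b) →
    Unique (branchPositionsWhere P us us⊆)
  branchPositionsWhere-unique P []       _   _         = []
  branchPositionsWhere-unique P (u ∷ us) us⊆ injective =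
    Unique.++⁺ (Unique.map⁺ child-injective (positionsWhere-unique P u))
               (branchPositionsWhere-unique P us (us⊆ ∘ there) λ a b → Fin.suc-injective ∘ injective (there a) (there b))
               disjoint
    where
    disjoint : Disjoint (map (child (us⊆ (here refl))) (positionsWhere P u)) (branchPositionsWhere P us (us⊆ ∘ there))
    disjoint (p∈u , p∈us) with ∈-map⁻ (child (us⊆ (here refl))) p∈u
                             | ∈-branchPositionsWhere⁻ P us (us⊆ ∘ there) p∈us
    ... | _ , _ , refl | _ , m , _ , eq , _ with injective (here refl) (there m) (child-index eq)
    ... | ()

levelCount : ℕ → (ℕ → Bool) → ℕ → ℕ
levelCount k P zero    = fromBool (P 0)
levelCount k P (suc h) = fromBool (P 0) + k * levelCount k (P ∘ suc) h

mutual
  length-positionsWhere : ∀ {k h} P {t} → Full k h t → length (positionsWhere P t) ≡ levelCount k P h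
  length-positionsWhere P leaf = trans (length-consIf (P 0) root []) (+-identityʳ _)
  length-positionsWhere {k} {suc h} P {node ts} (internal len full) = begin
    length (positionsWhere P (node ts))                   ≡⟨ length-consIf (P 0) root _ ⟩
    fromBool (P 0) + length (branchPositionsWhere (P ∘ suc) ts id)
      ≡⟨ cong (fromBool (P 0) +_) (length-branchPositionsWhere (P ∘ suc) ts id full) ⟩
    fromBool (P 0) + length ts * levelCount k (P ∘ suc) h
      ≡⟨ cong (λ l → fromBool (P 0) + l * levelCount k (P ∘ suc) h) len ⟩
    levelCount k P (suc h)                                ∎
    where open ≡-Reasoning

  length-branchPositionsWhere : ∀ {k h} P {ts} us (us⊆ : us ⊆ ts) → All (Full k h) us →
    length (branchPositionsWhere P us us⊆) ≡ length us * levelCount k P h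
  length-branchPositionsWhere P []       _   []            = refl
  length-branchPositionsWhere P (u ∷ us) us⊆ (full-u ∷ full) =
    trans (length-++ (map (child (us⊆ (here refl))) (positionsWhere P u)))
          (cong₂ _+_ (trans (length-map _ (positionsWhere P u)) (length-positionsWhere P full-u))
                     (length-branchPositionsWhere P us (us⊆ ∘ there) full))

vertexCount : ℕ → ℕ → ℕ
vertexCount k h = levelCount k (λ _ → true) h

vertexCount-nonZero : ∀ k h → NonZero (vertexCount k h)
vertexCount-nonZero _ zero    = _
vertexCount-nonZero _ (suc _) = _

vertexCount-enumeration : ∀ {k h t n} → Full k h t → Pos t ↔ Fin n → n ≡ vertexCount k h
vertexCount-enumeration {t = t} full t↔n = trans
  (sym (enumeration-length t↔n (positionsWhere _ t) (positionsWhere-unique _ t) (λ p → ∈-positionsWhere⁺ _ p refl)))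
  (length-positionsWhere _ full)

atHeights : (ℕ → Bool) → ℕ → (t : Tree) → List (Pos t)
atHeights Q h = positionsWhere (λ d → Q (h ∸ d))

heightCount : ℕ → (ℕ → Bool) → ℕ → ℕ
heightCount k Q h = levelCount k (λ d → Q (h ∸ d)) h

∉-atHeights : ∀ Q {h t} {p : Pos t} → p ∉ atHeights Q h t → Q (height h p) ≡ false
∉-atHeights Q {p = p} p∉ = ¬-not (p∉ ∘ ∈-positionsWhere⁺ _ p)

atHeights-IsCdn : ∀ {k h t} → Full k h t → ∀ Q → ClawFreeAfterDeleting (treeGraph t) (atHeights Q h t) →
  ClawPacking (treeGraph t) (atHeights Q h t) → IsCdn (treeGraph t) (heightCount k Q h)
atHeights-IsCdn {t = t} full Q claw-free packing = subst (IsCdn (treeGraph t)) (length-positionsWhere _ full)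
  (packing⇒IsCdn _≟ₚ_ packing (positionsWhere-unique _ t) claw-free)

-- For δ n the distance from height n up to the nearest selected height, owner sends each vertex of
-- the claw built at a selected vertex p back to p.
module Owner {t : Tree} (h : ℕ) (δ : ℕ → ℕ) where
  owner : Pos t → Pos t
  owner p = ancestorAbove (δ (height h p)) p

  owner-self : ∀ {p} → δ (height h p) ≡ 0 → owner p ≡ p
  owner-self {p} δ≡0 = trans (cong (λ i → ancestorAbove i p) δ≡0) (ancestorAt-depth p)

  owner-Edge : ∀ {p q} → Edge p q → δ (height h q) ≡ suc (δ (height h p)) → owner q ≡ owner p
  owner-Edge {p} {q} e δ-step = trans (cong (λ i → ancestorAbove i q) δ-step) (ancestorAbove-Edge e (δ (height h p)))

-- k ≥ 3: deleting the vertices of odd height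

odd : ℕ → Bool
odd zero    = false
odd (suc n) = not (odd n)

odd⇒≢0 : ∀ {n} → odd n ≡ true → n ≢ 0
odd⇒≢0 {zero} ()
odd⇒≢0 {suc _} _ ()

module OddHeights {k h t} (full : Full k h t) where

  Edge-odd : ∀ {p q} → Edge p q → odd (height h p) ≡ not (odd (height h q))
  Edge-odd e = cong odd (Edge-height full e)

  ¬Adj-even : ∀ {p q} → odd (height h p) ≡ false → odd (height h q) ≡ false → ¬ Adj (treeGraph t) p q
  ¬Adj-even p-even q-even (inj₁ e) = ¬Edge-even e p-even q-even
    where
    ¬Edge-even : ∀ {p q} → Edge p q → odd (height h p) ≡ false → odd (height h q) ≡ false → ⊥
    ¬Edge-even e p-even q-even with trans (sym p-even) (trans (Edge-odd e) (cong not q-even))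
    ... | ()
  ¬Adj-even p-even q-even (inj₂ e) = ¬Adj-even q-even p-even (inj₁ e)

  oddHeights-claw-free : ClawFreeAfterDeleting (treeGraph t) (atHeights odd h t)
  oddHeights-claw-free C = ¬Adj-even (∉-atHeights odd c∉S) (∉-atHeights odd x∉S) cx
    where open InducedClawAvoiding C

  oddOffset : ℕ → ℕ
  oddOffset n = fromBool (not (odd n))

  open Owner {t} h oddOffset

  oddHeights-packing : 3 ≤ k → ClawPacking (treeGraph t) (atHeights odd h t)
  oddHeights-packing 3≤k = record { owner = owner ; claw = λ {p} p∈ → clawAt p (∈-positionsWhere⁻ _ p p∈) }
    where
    clawAt : ∀ p → odd (height h p) ≡ true →
      Σ (InducedClaw (treeGraph t)) λ C → All (λ v → owner v ≡ p) (InducedClaw.vertices C)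
    clawAt p p-odd with three-children full 3≤k p (m∸n≢0⇒n<m (odd⇒≢0 p-odd))
    ... | c₁ , c₂ , c₃ , e₁ , e₂ , e₃ , c₁≢c₂ , c₁≢c₃ , c₂≢c₃ =
      record { c = p ; x = c₁ ; y = c₂ ; z = c₃
             ; cx = inj₁ e₁ ; cy = inj₁ e₂ ; cz = inj₁ e₃
             ; x≢y = c₁≢c₂ ; x≢z = c₁≢c₃ ; y≢z = c₂≢c₃
             ; ¬xy = ¬Adj-equal-depth (siblings e₁ e₂)
             ; ¬xz = ¬Adj-equal-depth (siblings e₁ e₃)
             ; ¬yz = ¬Adj-equal-depth (siblings e₂ e₃) } ,
      p-owned ∷ owned e₁ ∷ owned e₂ ∷ owned e₃ ∷ []
      where
      siblings : ∀ {q q′} → Edge p q → Edge p q′ → depth q ≡ depth q′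
      siblings e e′ = trans (Edge-depth e) (sym (Edge-depth e′))
      p-owned : owner p ≡ p
      p-owned = owner-self (cong (fromBool ∘ not) p-odd)
      owned : ∀ {q} → Edge p q → owner q ≡ p
      owned {q} e = trans (owner-Edge e offset-step) p-owned
        where
        q-even : odd (height h q) ≡ false
        q-even = not-injective (trans (sym (Edge-odd e)) p-odd)
        offset-step : oddOffset (height h q) ≡ suc (oddOffset (height h p))
        offset-step = trans (cong (fromBool ∘ not) q-even) (cong (suc ∘ fromBool ∘ not) (sym p-odd))

-- k = 2: deleting the vertices of height ≡ 2 (mod 3)

data Residue₃ : Set where
  zero₃ one₃ two₃ : Residue₃

suc₃ : Residue₃ → Residue₃
suc₃ zero₃ = one₃
suc₃ one₃  = two₃
suc₃ two₃  = zero₃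

residue₃ : ℕ → Residue₃
residue₃ zero    = zero₃
residue₃ (suc n) = suc₃ (residue₃ n)

toℕ₃ : Residue₃ → ℕ
toℕ₃ zero₃ = 0
toℕ₃ one₃  = 1
toℕ₃ two₃  = 2

isTwo₃ : Residue₃ → Bool
isTwo₃ two₃ = true
isTwo₃ _    = false

twoMod3 : ℕ → Bool
twoMod3 n = isTwo₃ (residue₃ n)

isTwo₃⇒≡two₃ : ∀ {z} → isTwo₃ z ≡ true → z ≡ two₃
isTwo₃⇒≡two₃ {two₃} _ = refl

suc₃≡two₃ : ∀ {z} → suc₃ z ≡ two₃ → z ≡ one₃
suc₃≡two₃ {one₃} _ = refl

≡two₃⇒≢zero₃ : ∀ {z} → z ≡ two₃ → z ≢ zero₃
≡two₃⇒≢zero₃ refl ()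

≡one₃⇒≢zero₃ : ∀ {z} → z ≡ one₃ → z ≢ zero₃
≡one₃⇒≢zero₃ refl ()

-- Distance from a height with residue z up to the nearest height with residue two₃.
offset₃ : Residue₃ → ℕ
offset₃ zero₃ = 2
offset₃ one₃  = 1
offset₃ two₃  = 0

offset₃-suc₃ : ∀ z → suc₃ z ≢ zero₃ → offset₃ z ≡ suc (offset₃ (suc₃ z))
offset₃-suc₃ zero₃ _ = refl
offset₃-suc₃ one₃  _ = refl
offset₃-suc₃ two₃  z≢ = ⊥-elim (z≢ refl)

¬three-consecutive-¬twoMod3 : ∀ n → twoMod3 n ≡ false → twoMod3 (1 + n) ≡ false → twoMod3 (2 + n) ≡ false → ⊥
¬three-consecutive-¬twoMod3 n with residue₃ n
... | zero₃ = λ _ _ ()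
... | one₃  = λ _ ()
... | two₃  = λ ()

module TwoMod3Heights {h t} (full : Full 2 h t) where

  centre-parent-child : ∀ {S} (C : InducedClawAvoiding (treeGraph t) S) → let open InducedClawAvoiding C in
    Σ (Pos t) λ v → Σ (Pos t) λ w → v ∉ S × w ∉ S × Edge v c × Edge c w
  centre-parent-child {S} C = cases cx cy cz
    where
    open InducedClawAvoiding C
    cases : Adj (treeGraph t) c x → Adj (treeGraph t) c y → Adj (treeGraph t) c z →
      Σ (Pos t) λ v → Σ (Pos t) λ w → v ∉ S × w ∉ S × Edge v c × Edge c w
    cases (inj₂ ex) (inj₂ ey) _         = ⊥-elim (x≢y (Edge-parent-unique ex ey))
    cases (inj₂ ex) (inj₁ ey) _         = _ , _ , x∉S , y∉S , ex , ey
    cases (inj₁ ex) (inj₂ ey) _         = _ , _ , y∉S , x∉S , ey , ex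
    cases (inj₁ ex) (inj₁ _)  (inj₂ ez) = _ , _ , z∉S , x∉S , ez , ex
    cases (inj₁ ex) (inj₁ ey) (inj₁ ez) with three-children⇒3≤k full ex ey ez x≢y x≢z y≢z
    ... | s≤s (s≤s ())

  twoMod3Heights-claw-free : ClawFreeAfterDeleting (treeGraph t) (atHeights twoMod3 h t)
  twoMod3Heights-claw-free C with centre-parent-child C
  ... | v , w , v∉S , w∉S , ev , ew =
    ¬three-consecutive-¬twoMod3 (height h w)
      (∉-atHeights twoMod3 w∉S)
      (subst (λ n → twoMod3 n ≡ false) c-height (∉-atHeights twoMod3 c∉S))
      (subst (λ n → twoMod3 n ≡ false) (trans (Edge-height full ev) (cong suc c-height)) (∉-atHeights twoMod3 v∉S))
    where
    open InducedClawAvoiding C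
    c-height : height h c ≡ suc (height h w)
    c-height = Edge-height full ew

  open Owner {t} h (offset₃ ∘ residue₃)

  owner-Edge₃ : ∀ {p q} → Edge p q → residue₃ (height h p) ≢ zero₃ → owner q ≡ owner p
  owner-Edge₃ {p} {q} e p≢zero₃ =
    owner-Edge e (trans (offset₃-suc₃ _ (p≢zero₃ ∘ trans p≡suc₃q)) (cong (suc ∘ offset₃) (sym p≡suc₃q)))
    where
    p≡suc₃q : residue₃ (height h p) ≡ suc₃ (residue₃ (height h q))
    p≡suc₃q = cong residue₃ (Edge-height full e)

  residue≢zero₃⇒depth<h : ∀ {p : Pos t} → residue₃ (height h p) ≢ zero₃ → depth p < h
  residue≢zero₃⇒depth<h r≢zero₃ = m∸n≢0⇒n<m (r≢zero₃ ∘ cong residue₃)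

  child-of-two₃ : ∀ {p c} → residue₃ (height h p) ≡ two₃ → Edge p c → residue₃ (height h c) ≡ one₃
  child-of-two₃ p-two e = suc₃≡two₃ (trans (sym (cong residue₃ (Edge-height full e))) p-two)

  twoMod3Heights-packing : ClawPacking (treeGraph t) (atHeights twoMod3 h t)
  twoMod3Heights-packing = record
    { owner = owner ; claw = λ {p} p∈ → clawAt p (isTwo₃⇒≡two₃ (∈-positionsWhere⁻ _ p p∈)) }
    where
    clawAt : ∀ p → residue₃ (height h p) ≡ two₃ →
      Σ (InducedClaw (treeGraph t)) λ C → All (λ v → owner v ≡ p) (InducedClaw.vertices C)
    clawAt p p-two with two-children full (s≤s (s≤s z≤n)) p (residue≢zero₃⇒depth<h (≡two₃⇒≢zero₃ p-two))
    ... | c , _ , ep , _ , _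
      with two-children full (s≤s (s≤s z≤n)) c (residue≢zero₃⇒depth<h (≡one₃⇒≢zero₃ (child-of-two₃ p-two ep)))
    ... | g₁ , g₂ , e₁ , e₂ , g₁≢g₂ =
      record { c = c ; x = p ; y = g₁ ; z = g₂
             ; cx = inj₂ ep ; cy = inj₁ e₁ ; cz = inj₁ e₂
             ; x≢y = p≢g e₁ ; x≢z = p≢g e₂ ; y≢z = g₁≢g₂
             ; ¬xy = ¬Adj-depth-gap-2 (grandchild e₁)
             ; ¬xz = ¬Adj-depth-gap-2 (grandchild e₂)
             ; ¬yz = ¬Adj-equal-depth (trans (Edge-depth e₁) (sym (Edge-depth e₂))) } ,
      c-owned ∷ p-owned ∷ g-owned e₁ ∷ g-owned e₂ ∷ []
      where
      grandchild : ∀ {g} → Edge c g → depth g ≡ 2 + depth p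
      grandchild e = trans (Edge-depth e) (cong suc (Edge-depth ep))
      p≢g : ∀ {g} → Edge c g → p ≢ g
      p≢g e p≡g = m≢1+n+m (depth p) (trans (cong depth p≡g) (grandchild e))
      p-owned : owner p ≡ p
      p-owned = owner-self (cong offset₃ p-two)
      c-owned : owner c ≡ p
      c-owned = trans (owner-Edge₃ ep (≡two₃⇒≢zero₃ p-two)) p-owned
      g-owned : ∀ {g} → Edge c g → owner g ≡ p
      g-owned e = trans (owner-Edge₃ e (≡one₃⇒≢zero₃ (child-of-two₃ p-two ep))) c-owned

vertexCount-closed : ∀ k′ h → k′ * vertexCount (suc k′) h + 1 ≡ suc k′ ^ suc h
vertexCount-closed k′ zero    = identity₀ k′
  where
  identity₀ : ∀ k′ → k′ * 1 + 1 ≡ suc k′ * 1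
  identity₀ = solve-∀
vertexCount-closed k′ (suc h) = trans (identity k′ (vertexCount (suc k′) h)) (cong (suc k′ *_) (vertexCount-closed k′ h))
  where
  identity : ∀ k′ N → k′ * (1 + suc k′ * N) + 1 ≡ suc k′ * (k′ * N + 1)
  identity = solve-∀

fromBool-odd : ∀ n → fromBool (odd n) ≡ n % 2
fromBool-odd 0             = refl
fromBool-odd 1             = refl
fromBool-odd (suc (suc n)) = begin
  fromBool (not (not (odd n))) ≡⟨ cong fromBool (not-involutive (odd n)) ⟩
  fromBool (odd n)             ≡⟨ fromBool-odd n ⟩
  n % 2                        ≡⟨ [m+n]%n≡m%n n 2 ⟨
  (n + 2) % 2                  ≡⟨ cong (_% 2) (+-comm n 2) ⟩
  (2 + n) % 2                  ∎
  where open ≡-Reasoning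

oddCount-closed : ∀ k′ h → (suc k′ + 1) * k′ * heightCount (suc k′) odd h + suc k′ ^ (suc h % 2) ≡ suc k′ ^ suc h
oddCount-closed k′ h = subst (λ r → (suc k′ + 1) * k′ * heightCount (suc k′) odd h + suc k′ ^ r ≡ suc k′ ^ suc h)
  (fromBool-odd (suc h)) (closed h)
  where
  even-step : ∀ k′ c → (suc k′ + 1) * k′ * (0 + suc k′ * c) + suc k′ * 1 ≡ suc k′ * ((suc k′ + 1) * k′ * c + 1)
  even-step = solve-∀
  odd-step : ∀ k′ c → (suc k′ + 1) * k′ * (1 + suc k′ * c) + 1 ≡ suc k′ * ((suc k′ + 1) * k′ * c + suc k′ * 1)
  odd-step = solve-∀
  step : ∀ b {c m} → (suc k′ + 1) * k′ * c + suc k′ ^ fromBool b ≡ m →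
    (suc k′ + 1) * k′ * (fromBool b + suc k′ * c) + suc k′ ^ fromBool (not b) ≡ suc k′ * m
  step false {c} refl = even-step k′ c
  step true  {c} refl = odd-step k′ c
  closed : ∀ h → (suc k′ + 1) * k′ * heightCount (suc k′) odd h + suc k′ ^ fromBool (odd (suc h)) ≡ suc k′ ^ suc h
  closed zero    = cong (_+ suc k′ ^ 1) (*-zeroʳ ((suc k′ + 1) * k′))
  closed (suc h) = step (odd (suc h)) (closed h)

toℕ₃-residue₃ : ∀ n → toℕ₃ (residue₃ n) ≡ n % 3
toℕ₃-residue₃ 0 = refl
toℕ₃-residue₃ 1 = refl
toℕ₃-residue₃ 2 = refl
toℕ₃-residue₃ (suc (suc (suc n))) = begin
  toℕ₃ (suc₃ (suc₃ (suc₃ (residue₃ n)))) ≡⟨ cong toℕ₃ (suc₃-period (residue₃ n)) ⟩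
  toℕ₃ (residue₃ n)                      ≡⟨ toℕ₃-residue₃ n ⟩
  n % 3                                  ≡⟨ [m+n]%n≡m%n n 3 ⟨
  (n + 3) % 3                            ≡⟨ cong (_% 3) (+-comm n 3) ⟩
  (3 + n) % 3                            ∎
  where
  open ≡-Reasoning
  suc₃-period : ∀ z → suc₃ (suc₃ (suc₃ z)) ≡ z
  suc₃-period zero₃ = refl
  suc₃-period one₃  = refl
  suc₃-period two₃  = refl

twoMod3Count-closed : ∀ h → 7 * heightCount 2 twoMod3 h + 2 ^ (suc h % 3) ≡ 2 ^ suc h
twoMod3Count-closed h = subst (λ r → 7 * heightCount 2 twoMod3 h + 2 ^ r ≡ 2 ^ suc h) (toℕ₃-residue₃ (suc h)) (closed h)
  where
  step₀ : ∀ c → 7 * (0 + 2 * c) + 2 ≡ 2 * (7 * c + 1)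
  step₀ = solve-∀
  step₁ : ∀ c → 7 * (0 + 2 * c) + 4 ≡ 2 * (7 * c + 2)
  step₁ = solve-∀
  step₂ : ∀ c → 7 * (1 + 2 * c) + 1 ≡ 2 * (7 * c + 4)
  step₂ = solve-∀
  step : ∀ z {c m} → 7 * c + 2 ^ toℕ₃ z ≡ m → 7 * (fromBool (isTwo₃ z) + 2 * c) + 2 ^ toℕ₃ (suc₃ z) ≡ 2 * m
  step zero₃ {c} refl = step₀ c
  step one₃  {c} refl = step₁ c
  step two₃  {c} refl = step₂ c
  closed : ∀ h → 7 * heightCount 2 twoMod3 h + 2 ^ toℕ₃ (residue₃ (suc h)) ≡ 2 ^ suc h
  closed zero    = refl
  closed (suc h) = step (residue₃ (suc h)) {heightCount 2 twoMod3 h} (closed h)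

/ℚ-cross : ∀ a b c d .{{_ : NonZero b}} .{{_ : NonZero d}} → a * d ≡ c * b → a /ℚ b ≡ c /ℚ d
/ℚ-cross a (suc b) c (suc d) ad≡cb = fromℚᵘ-cong {mkℚᵘ (ℤ.+ a) b} {mkℚᵘ (ℤ.+ c) d}
  (*≡* (trans (sym (ℤ.pos-* a (suc d))) (trans (cong ℤ.+_ ad≡cb) (ℤ.pos-* c (suc b)))))

module _ {c N K d e : ℕ} .{{_ : NonZero N}} .{{_ : NonZero d}} .{{_ : NonZero e}}
         (N-closed : d * N + 1 ≡ K) where

  ratio-closed : ∀ {r} → e * d * c + r ≡ K → c /ℚ N ≡ (K ∸ r) /ℚ (e * (K ∸ 1))
  ratio-closed {r} c-closed = begin
    c /ℚ N                       ≡⟨ /ℚ-cross c N (e * d * c) (e * (d * N)) (rearrange c N d e) ⟩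
    (e * d * c) /ℚ (e * (d * N)) ≡⟨ cong₂ (λ a b → a /ℚ (e * b)) (difference c-closed) (difference N-closed) ⟩
    (K ∸ r) /ℚ (e * (K ∸ 1))     ∎
    where
    open ≡-Reasoning
    instance
      dN≢0 : NonZero (d * N)
      dN≢0 = m*n≢0 d N
      edN≢0 : NonZero (e * (d * N))
      edN≢0 = m*n≢0 e (d * N)
    rearrange : ∀ c N d e → c * (e * (d * N)) ≡ e * d * c * N
    rearrange = solve-∀
    difference : ∀ {a b} → a + b ≡ K → a ≡ K ∸ b
    difference {a} {b} a+b≡K = trans (sym (m+n∸n≡m a b)) (cong (_∸ b) a+b≡K)

  ratio-closed-1 : ∀ {r} → e * d * c + r ≡ K → r ≡ 1 → c /ℚ N ≡ 1 /ℚ e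
  ratio-closed-1 c-closed refl = /ℚ-cross c N 1 e (trans (*-comm c e) (trans ec≡N (sym (*-identityˡ N))))
    where
    ec≡N : e * c ≡ N
    ec≡N = *-cancelˡ-≡ (e * c) N d (begin
      d * (e * c) ≡⟨ reassociate d e c ⟩
      e * d * c   ≡⟨ +-cancelʳ-≡ 1 (e * d * c) (d * N) (trans c-closed (sym N-closed)) ⟩
      d * N       ∎)
      where
      open ≡-Reasoning
      reassociate : ∀ d e c → d * (e * c) ≡ e * d * c
      reassociate = solve-∀

open TwoMod3Heights using (twoMod3Heights-claw-free; twoMod3Heights-packing)
open OddHeights using (oddHeights-claw-free; oddHeights-packing)

corollary5 : (k h n : ℕ) (T : Tree) → 2 ≤ k → Full k h T → (Pos T ↔ Fin n) →
    Σ ℕ (λ c → IsCdn (treeGraph T) c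
      × (k ≡ 2 → c /ℚ n ≡ (2 ^ (h + 1) ∸ 2 ^ ((h + 1) % 3)) /ℚ (7 * (2 ^ (h + 1) ∸ 1)))
      × (3 ≤ k → c /ℚ n ≡ (k ^ (h + 1) ∸ k ^ ((h + 1) % 2)) /ℚ ((k + 1) * (k ^ (h + 1) ∸ 1)))
      × ((h + 1) % 3 ≡ 0 → (h + 1) % 2 ≡ 0 →
          (k ≡ 2 → c /ℚ n ≡ 1 /ℚ 7) × (3 ≤ k → c /ℚ n ≡ 1 /ℚ (k + 1))))
corollary5 1 _ _ _ (s≤s ()) _ _
corollary5 2 h n T _ full T↔n rewrite vertexCount-enumeration full T↔n | +-comm h 1 =
  heightCount 2 twoMod3 h ,
  atHeights-IsCdn full twoMod3 (twoMod3Heights-claw-free full) (twoMod3Heights-packing full) ,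
  (λ _ → ratio-closed {d = 1} {e = 7} N-closed c-closed) ,
  (λ { (s≤s (s≤s ())) }) ,
  λ t≡0 _ → (λ _ → ratio-closed-1 {d = 1} {e = 7} N-closed c-closed (cong (2 ^_) t≡0)) , λ { (s≤s (s≤s ())) }
  where
  instance
    N≢0 : NonZero (vertexCount 2 h)
    N≢0 = vertexCount-nonZero 2 h
  N-closed : 1 * vertexCount 2 h + 1 ≡ 2 ^ suc h
  N-closed = vertexCount-closed 1 h
  c-closed : 7 * heightCount 2 twoMod3 h + 2 ^ (suc h % 3) ≡ 2 ^ suc h
  c-closed = twoMod3Count-closed h
corollary5 k@(suc k′@(suc (suc _))) h n T _ full T↔n rewrite vertexCount-enumeration full T↔n | +-comm h 1 =
  heightCount k odd h ,
  atHeights-IsCdn full odd (oddHeights-claw-free full) (oddHeights-packing full (s≤s (s≤s (s≤s z≤n)))) ,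
  (λ ()) ,
  (λ _ → ratio-closed {d = k′} {e = k + 1} N-closed c-closed) ,
  λ _ t≡0 → (λ ()) , λ _ → ratio-closed-1 {d = k′} {e = k + 1} N-closed c-closed (cong (k ^_) t≡0)
  where
  instance
    N≢0 : NonZero (vertexCount k h)
    N≢0 = vertexCount-nonZero k h
  N-closed : k′ * vertexCount k h + 1 ≡ k ^ suc h
  N-closed = vertexCount-closed k′ h
  c-closed : (k + 1) * k′ * heightCount k odd h + k ^ (suc h % 2) ≡ k ^ suc h
  c-closed = oddCount-closed k′ h
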